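{- Let $n\in\mathbb{N}$ and let $D\subseteq S_{0}$ be a $C$-set in the semigroup $(S_{0},\cdot)$. Then there exists a sequence $(w_{i})_{i=1}^{\infty}$ in $S_{n}$ such that for every $l\in\mathbb{N}$, every $m_{1}<m_{2}<\cdots<m_{l}$ in $\mathbb{N}$ and every $\vec{a}_{1}\in\mathbb{A}_{m_{1}}^{n},\dots,\vec{a}_{l}\in\mathbb{A}_{m_{l}}^{n}$, \[ w_{m_{1}}(\vec{a}_{1})\,w_{m_{2}}(\vec{a}_{2})\cdots w_{m_{l}}(\vec{a}_{l})\in D. \]
   Context: Let $\mathbb{A}_{1}\subseteq\mathbb{A}_{2}\subseteq\cdots$ be an increasing sequence of finite nonempty alphabets and $\mathbb{A}=\bigcup_{i}\mathbb{A}_{i}$. $S_{0}$ is the set of all nonempty finite words over $\mathbb{A}$, a semigroup under concatenation. For $n\in\mathbb{N}$ let $v_{1},\dots,v_{n}$ be distinct variables not in $\mathbb{A}$; $S_{n}$ is the set of words over $\mathbb{A}\cup\{v_{1},\dots,v_{n}\}$ in which each $v_{i}$ occurs at least once. For $w\in S_{n}$ and $\vec{a}=(a_{1},\dots,a_{n})\in\mathbb{A}^{n}$, $w(\vec{a})$ is obtained by replacing each occurrence of $v_{i}$ by $a_{i}$. For a semigroup $S$, a set $B\subseteq S$ is a $J$-set if for every finite nonempty set $F$ of sequences $f:\mathbb{N}\to S$ there exist $m\in\mathbb{N}$, $a_{1},\dots,a_{m+1}\in S$ and $t_{1}<\cdots<t_{m}$ in $\mathbb{N}$ with $a_{1}f(t_{1})\cdots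 a_{m}f(t_{m})a_{m+1}\in B$ for all $f\in F$. $J(S)$ is the set of ultrafilters $p\in\beta S$ all of whose members are $J$-sets, and $B$ is a $C$-set if $B\in p$ for some idempotent $p\in J(S)$ (in the Stone–Čech compactification $\beta S$ with its extended semigroup operation). -}

module Defs where

open import Level using (0ℓ)
open import Data.Nat using (ℕ; zero; suc)
open import Data.Fin as Fin using (Fin; zero; suc)
open import Data.Product using (Σ; _×_; _,_)
open import Data.Sum using (_⊎_; [_,_])
open import Data.Unit using (⊤)
open import Data.Empty using (⊥)
open import Data.List.NonEmpty using (List⁺; toList; _⁺++⁺_)
import Data.List.NonEmpty as L⁺
open import Data.List.Membership.Propositional using (_∈_)
open import Relation.Nullary using (¬_)
open import Relation.Unary using (Pred; _⊆_; _∩_; ∁)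
open import Function using (id; _∘_)

module _ {S : Set} (_·_ : S → S → S) where

  jword : (m : ℕ) → (Fin (suc m) → S) → (Fin m → ℕ) → (ℕ → S) → S
  jword zero    a t f = a zero
  jword (suc m) a t f = a zero · (f (t zero) · jword m (a ∘ suc) (t ∘ suc) f)

  -- J-set: for every finite nonempty set F of sequences (given as a
  -- nonempty list), there are m ≥ 1 (m = suc k), a₁..a_{m+1}, t₁<..<t_m
  -- with a₁ f(t₁) ... a_m f(t_m) a_{m+1} ∈ B for all f ∈ F.
  IsJSet : Pred S 0ℓ → Set
  IsJSet B = (F : List⁺ (ℕ → S)) →
    Σ ℕ λ k → Σ (Fin (suc (suc k)) → S) λ a → Σ (Fin (suc k) → ℕ) λ t →
      ((i j : Fin (suc k)) → i Fin.< j → t i Data.Nat.< t j) ×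
      ((f : ℕ → S) → f ∈ toList F → B (jword (suc k) a t f))

  _⁻¹_ : S → Pred S 0ℓ → Pred S 0ℓ
  (x ⁻¹ A) y = A (x · y)

record Ultrafilter (S : Set) : Set₁ where
  field
    _∋_      : Pred S 0ℓ → Set
    univ     : _∋_ (λ _ → ⊤)
    noEmpty  : ¬ _∋_ (λ _ → ⊥)
    upward   : ∀ {A B} → A ⊆ B → _∋_ A → _∋_ B
    meet     : ∀ {A B} → _∋_ A → _∋_ B → _∋_ (A ∩ B)
    ultra    : ∀ A → _∋_ A ⊎ _∋_ (∁ A)
open Ultrafilter public

module _ {S : Set} (_·_ : S → S → S) where

  -- Extended operation on βS: A ∈ p·q  iff  { x : x⁻¹A ∈ q } ∈ p.
  -- p is idempotent iff p·p = p, i.e. they have the same members.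
  IsIdempotent : Ultrafilter S → Set₁
  IsIdempotent p = (A : Pred S 0ℓ) →
    ((p ∋ A) → (p ∋ (λ x → p ∋ _⁻¹_ _·_ x A))) ×
    ((p ∋ (λ x → p ∋ _⁻¹_ _·_ x A)) → (p ∋ A))

  InJ : Ultrafilter S → Set₁
  InJ p = (A : Pred S 0ℓ) → p ∋ A → IsJSet _·_ A

  IsCSet : Pred S 0ℓ → Set₁
  IsCSet D = Σ (Ultrafilter S) λ p → IsIdempotent p × InJ p × (p ∋ D)

S₀ : Set → Set
S₀ A = List⁺ A

VWord : Set → ℕ → Set
VWord A n = List⁺ (A ⊎ Fin n)

InSn : {A : Set} {n : ℕ} → VWord A n → Set
InSn {n = n} w = (i : Fin n) → Data.Sum.inj₂ i ∈ toList w

subst : {A : Set} {n : ℕ} → VWord A n → (Fin n → A) → S₀ A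
subst w a = L⁺.map [ id , a ] w

concatW : {A : Set} (k : ℕ) → (Fin (suc k) → S₀ A) → S₀ A
concatW zero    u = u zero
concatW (suc k) u = u zero ⁺++⁺ concatW k (u ∘ suc)

-- Fix an idempotent p ∈ J(S₀) with D ∈ p, and write E⋆ = {x : x⁻¹E ∈ p}; idempotence
-- gives E⋆ ∈ p whenever E ∈ p. Given E ∈ p and a stage m, apply the J-set property of
-- E ∩ E⋆ ∈ p to the finitely many constant sequences t ↦ (v₁⋯vₙ)(a⃗), a⃗ ∈ 𝔸_mⁿ: this
-- yields one variable word w with w(a⃗) ∈ E ∩ E⋆ for every such a⃗. Starting from
-- E₀ = D, choose w_m for E_m and pass to E_{m+1} = E_m ∩ ⋂_{a⃗} w_m(a⃗)⁻¹E_m, still in p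
-- as a finite intersection. Induction on l then puts w_{m₁}(a⃗₁)⋯w_{m_l}(a⃗_l) in E_{m₁} ⊆ D.

module Submission where

open import Defs
open import Level using (0ℓ)
open import Data.Nat using (ℕ; zero; suc; _≤_; _<_; z≤n; s≤s; _≤′_; ≤′-refl; ≤′-step)
open import Data.Nat.Properties using (≤⇒≤′)
open import Data.Fin using (Fin; zero; suc)
import Data.Fin
open import Data.Product using (Σ; _×_; _,_; proj₁; proj₂; ∃)
open import Data.Sum using (inj₁; inj₂)
open import Data.Sum.Properties using ([,-]-cong)
open import Data.List using (List; []; _∷_; [_]; tabulate; cartesianProductWith)
open import Data.List.NonEmpty using (List⁺; toList; _⁺++⁺_)
import Data.List.NonEmpty as List⁺
open import Data.List.NonEmpty.Properties using (map-⁺++⁺; map-cong; map-∘; map-id)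
open import Data.List.Relation.Unary.Any using (here; there)
open import Data.List.Membership.Propositional using (_∈_)
open import Data.List.Membership.Propositional.Properties
  using (∈-map⁺; ∈-++⁺ˡ; ∈-++⁺ʳ; ∈-tabulate⁺; ∈-cartesianProductWith⁺; ∈-cartesianProductWith⁻)
import Data.Vec.Functional as Vector
open import Relation.Unary using (Pred; _⊆_; _∩_)
open import Relation.Binary.PropositionalEquality
  using (_≡_; _≗_; refl; sym; trans; cong; cong₂; module ≡-Reasoning)
  renaming (subst to transport)
open import Function using (id; _∘_)

Into : {A : Set} {n : ℕ} → List A → (Fin n → A) → Set
Into xs a = ∀ r → a r ∈ xs

functionsInto : {A : Set} (n : ℕ) → List A → List (Fin n → A)
functionsInto zero    xs = [ Vector.[] ]
functionsInto (suc n) xs = cartesianProductWith Vector._∷_ xs (functionsInto n xs)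

∈-functionsInto⁻ : {A : Set} (n : ℕ) (xs : List A) {b : Fin n → A} →
  b ∈ functionsInto n xs → Into xs b
∈-functionsInto⁻ (suc n) xs b∈ r
  with x , c , x∈ , c∈ , refl ← ∈-cartesianProductWith⁻ Vector._∷_ xs (functionsInto n xs) b∈
  with r
... | zero  = x∈
... | suc r = ∈-functionsInto⁻ n xs c∈ r

∈-functionsInto⁺ : {A : Set} (n : ℕ) (xs : List A) {a : Fin n → A} →
  Into xs a → ∃ λ b → b ∈ functionsInto n xs × a ≗ b
∈-functionsInto⁺ zero    xs a∈ = Vector.[] , here refl , λ ()
∈-functionsInto⁺ (suc n) xs {a} a∈
  with c , c∈ , a≗c ← ∈-functionsInto⁺ n xs (a∈ ∘ suc) =
  a zero Vector.∷ c ,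
  ∈-cartesianProductWith⁺ Vector._∷_ (a∈ zero) c∈ ,
  λ { zero → refl ; (suc r) → a≗c r }

∋-⋂ : {S X : Set} (p : Ultrafilter S) (xs : List X) (P : X → Pred S 0ℓ) →
  (∀ x → x ∈ xs → p ∋ P x) → p ∋ (λ s → ∀ x → x ∈ xs → P x s)
∋-⋂ p []       P ∋P = upward p (λ _ _ ()) (univ p)
∋-⋂ p (y ∷ ys) P ∋P =
  upward p (λ { (Py , Pys) _ (here refl) → Py ; (Py , Pys) x (there x∈) → Pys x x∈ })
    (meet p (∋P y (here refl)) (∋-⋂ p ys P (λ x x∈ → ∋P x (there x∈))))

lift : {A : Set} {n : ℕ} → S₀ A → VWord A n
lift = List⁺.map inj₁

subst-cong : {A : Set} {n : ℕ} (w : VWord A n) {a b : Fin n → A} → a ≗ b →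
  subst w a ≡ subst w b
subst-cong w a≗b = map-cong ([,-]-cong a≗b) w

subst-lift : {A : Set} {n : ℕ} (u : S₀ A) (a : Fin n → A) → subst (lift u) a ≡ u
subst-lift u a = trans (sym (map-∘ u)) (map-id u)

subst-jword : {A : Set} {n : ℕ} (m : ℕ) (b : Fin (suc m) → S₀ A) (t : Fin m → ℕ)
  (f : ℕ → VWord A n) (a : Fin n → A) →
  subst (jword _⁺++⁺_ m (lift ∘ b) t f) a ≡ jword _⁺++⁺_ m b t (λ i → subst (f i) a)
subst-jword zero    b t f a = subst-lift (b zero) a
subst-jword (suc m) b t f a = begin
  subst (lift (b zero) ⁺++⁺ (f (t zero) ⁺++⁺ rest)) a
    ≡⟨ map-⁺++⁺ _ (lift (b zero)) _ ⟩
  subst (lift (b zero)) a ⁺++⁺ subst (f (t zero) ⁺++⁺ rest) a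
    ≡⟨ cong₂ _⁺++⁺_ (subst-lift (b zero) a) (map-⁺++⁺ _ (f (t zero)) rest) ⟩
  b zero ⁺++⁺ (subst (f (t zero)) a ⁺++⁺ subst rest a)
    ≡⟨ cong (λ u → b zero ⁺++⁺ (subst (f (t zero)) a ⁺++⁺ u))
            (subst-jword m (b ∘ suc) (t ∘ suc) f a) ⟩
  jword _⁺++⁺_ (suc m) b t (λ i → subst (f i) a) ∎
  where
  open ≡-Reasoning
  rest = jword _⁺++⁺_ m (lift ∘ b ∘ suc) (t ∘ suc) f

allVariables : {A : Set} (n : ℕ) → VWord A (suc n)
allVariables n = List⁺.map inj₂ (zero List⁺.∷ tabulate suc)

allVariables-InSn : {A : Set} (n : ℕ) → InSn {A} (allVariables n)
allVariables-InSn n i = ∈-map⁺ inj₂ (∈-tabulate⁺ {f = id} i)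

module _ {A : Set} (p : Ultrafilter (S₀ A))
         (idem : IsIdempotent _⁺++⁺_ p) (inJ : InJ _⁺++⁺_ p) where

  _⋆ : Pred (S₀ A) 0ℓ → Pred (S₀ A) 0ℓ
  (E ⋆) x = p ∋ _⁻¹_ _⁺++⁺_ x E

  variableWord : {n : ℕ} {E : Pred (S₀ A) 0ℓ} → p ∋ E → (Φ : List⁺ (Fin (suc n) → A)) →
    Σ (VWord A (suc n)) λ W → InSn W × (∀ a → a ∈ toList Φ → (E ∩ E ⋆) (subst W a))
  variableWord {n} {E} ∋E Φ = W , W-InSn , W-good
    where
    v = allVariables n
    constant : (Fin (suc n) → A) → ℕ → S₀ A
    constant a _ = subst v a
    J = inJ (E ∩ E ⋆) (meet p ∋E (proj₁ (idem E) ∋E)) (List⁺.map constant Φ)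
    k = proj₁ J
    b = proj₁ (proj₂ J)
    t = proj₁ (proj₂ (proj₂ J))
    W : VWord A (suc n)
    W = jword _⁺++⁺_ (suc k) (lift ∘ b) t (λ _ → v)
    W-InSn : InSn W
    W-InSn i = ∈-++⁺ʳ (toList (lift {n = suc n} (b zero))) (∈-++⁺ˡ (allVariables-InSn n i))
    W-good : ∀ a → a ∈ toList Φ → (E ∩ E ⋆) (subst W a)
    W-good a a∈ = transport (E ∩ E ⋆) (sym (subst-jword (suc k) b t (λ _ → v) a))
      (proj₂ (proj₂ (proj₂ (proj₂ J))) (constant a) (∈-map⁺ constant a∈))

  variableWordInto : {n : ℕ} {E : Pred (S₀ A) 0ℓ} → p ∋ E → (X : List⁺ A) →
    Σ (VWord A (suc n)) λ W → InSn W × (∀ a → Into (toList X) a → (E ∩ E ⋆) (subst W a))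
  variableWordInto {n} {E} ∋E X = W , W-InSn , W-good
    where
    -- the constant assignment only serves to make Φ nonempty
    Φ = (λ _ → List⁺.head X) List⁺.∷ functionsInto (suc n) (toList X)
    Wφ = variableWord ∋E Φ
    W = proj₁ Wφ
    W-InSn = proj₁ (proj₂ Wφ)
    W-good : ∀ a → Into (toList X) a → (E ∩ E ⋆) (subst W a)
    W-good a a∈ with b , b∈ , a≗b ← ∈-functionsInto⁺ (suc n) (toList X) a∈ =
      transport (E ∩ E ⋆) (sym (subst-cong W a≗b)) (proj₂ (proj₂ Wφ) b (there b∈))

  ∋-⋂-⁻¹ : {n : ℕ} {E : Pred (S₀ A) 0ℓ} (X : List A) (W : VWord A n) →
    (∀ a → Into X a → (E ⋆) (subst W a)) →
    p ∋ (λ y → ∀ a → Into X a → E (subst W a ⁺++⁺ y))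
  ∋-⋂-⁻¹ {n} {E} X W ⋆W =
    upward p from-enumeration
      (∋-⋂ p (functionsInto n X) (λ b y → E (subst W b ⁺++⁺ y))
        (λ b b∈ → ⋆W b (∈-functionsInto⁻ n X b∈)))
    where
    from-enumeration : ∀ {y} → (∀ b → b ∈ functionsInto n X → E (subst W b ⁺++⁺ y)) →
      ∀ a → Into X a → E (subst W a ⁺++⁺ y)
    from-enumeration {y} E-enum a a∈ with b , b∈ , a≗b ← ∈-functionsInto⁺ n X a∈ =
      transport (λ u → E (u ⁺++⁺ y)) (sym (subst-cong W a≗b)) (E-enum b b∈)

  module Chain (Alph : ℕ → List⁺ A) (n : ℕ) (D : Pred (S₀ A) 0ℓ) (∋D : p ∋ D) where

    Stage : Set₁
    Stage = Σ (Pred (S₀ A) 0ℓ) (p ∋_)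

    wordFor : (m : ℕ) (s : Stage) →
      Σ (VWord A (suc n)) λ W → InSn W ×
        (∀ a → Into (toList (Alph m)) a → (proj₁ s ∩ proj₁ s ⋆) (subst W a))
    wordFor m (E , ∋E) = variableWordInto ∋E (Alph m)

    next : ℕ → Stage → Stage
    next m s@(E , ∋E) =
      (λ x → E x × (∀ a → Into (toList (Alph m)) a → E (subst W a ⁺++⁺ x))) ,
      meet p ∋E (∋-⋂-⁻¹ {E = E} (toList (Alph m)) W W∈E⋆)
      where
      W = proj₁ (wordFor m s)
      W∈E⋆ : ∀ a → Into (toList (Alph m)) a → (E ⋆) (subst W a)
      W∈E⋆ a a∈ = proj₂ (proj₂ (proj₂ (wordFor m s)) a a∈)

    stage : ℕ → Stage
    stage zero    = D , ∋D
    stage (suc m) = next m (stage m)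

    E : ℕ → Pred (S₀ A) 0ℓ
    E m = proj₁ (stage m)

    w : ℕ → VWord A (suc n)
    w m = proj₁ (wordFor m (stage m))

    w-InSn : ∀ m → InSn (w m)
    w-InSn m = proj₁ (proj₂ (wordFor m (stage m)))

    E-antitone : ∀ {m m'} → m ≤′ m' → E m' ⊆ E m
    E-antitone ≤′-refl       = id
    E-antitone (≤′-step m≤m') = E-antitone m≤m' ∘ proj₁

    product∈E : (k : ℕ) (m : Fin (suc k) → ℕ) →
      ((i j : Fin (suc k)) → i Data.Fin.< j → m i < m j) →
      (a : Fin (suc k) → Fin (suc n) → A) →
      ((j : Fin (suc k)) → Into (toList (Alph (m j))) (a j)) →
      E (m zero) (concatW k (λ j → subst (w (m j)) (a j)))
    product∈E zero m _ a a∈ =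
      proj₁ (proj₂ (proj₂ (wordFor (m zero) (stage (m zero)))) (a zero) (a∈ zero))
    product∈E (suc k) m m-inc a a∈ =
      proj₂ (E-antitone (≤⇒≤′ (m-inc zero (suc zero) (s≤s z≤n))) tail∈E) (a zero) (a∈ zero)
      where
      tail∈E = product∈E k (m ∘ suc) (λ i j i<j → m-inc (suc i) (suc j) (s≤s i<j))
                 (a ∘ suc) (a∈ ∘ suc)

mainTheorem4 : {A : Set} (Alph : ℕ → List⁺ A) →
    ((i : ℕ) (x : A) → x ∈ toList (Alph i) → x ∈ toList (Alph (suc i))) →
    ((x : A) → Σ ℕ λ i → x ∈ toList (Alph i)) →
    (n : ℕ) → 1 ≤ n →
    (D : Pred (S₀ A) 0ℓ) → IsCSet _⁺++⁺_ D →
    Σ (ℕ → VWord A n) λ w →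
    ((i : ℕ) → InSn (w i)) ×
    ((k : ℕ) (m : Fin (suc k) → ℕ) →
    ((i j : Fin (suc k)) → i Data.Fin.< j → m i < m j) →
    (a : Fin (suc k) → Fin n → A) →
    ((j : Fin (suc k)) (r : Fin n) → a j r ∈ toList (Alph (m j))) →
    D (concatW k (λ j → subst (w (m j)) (a j))))
mainTheorem4 Alph _ _ (suc n) (s≤s z≤n) D (p , idem , inJ , ∋D) =
  w , w-InSn , λ k m m-inc a a∈ → E-antitone (≤⇒≤′ (z≤n {m zero})) (product∈E k m m-inc a a∈)
  where open Chain p idem inJ Alph n D ∋D
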